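{- Let $n\ge1$, $0\le k\le n$, $0\le r<n$ be integers with $\gcd(n,k,r)=1$. Then there exist integers $x,y,z$ such that $nx+ky+rz=1$ and $\gcd(z,n)=1$. -}

module Defs where

{-# OPTIONS --safe #-}
module Submission where

-- Write g = gcd n k = n u + k v. As gcd g r = 1 there are x, y with g x + r y = 1, and then
-- g (x - r t) + r (y + g t) = 1 for every t, so it suffices to find t with y + g t coprime
-- to n. Take t = a, the largest divisor of n coprime to y. A common divisor d of n and y + g a
-- is coprime to y (a common divisor of d and y divides g a and is coprime to g, so it divides
-- a, which is coprime to y); hence d divides a, hence y, so d = 1.

open import Defs
open import Data.Nat using (ℕ; _≤_; _<_)
open import Data.Nat.GCD using (gcd)
open import Data.Integer using (ℤ; +_; _+_; _*_; ∣_∣)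
open import Data.Product using (Σ; _×_)
open import Relation.Binary.PropositionalEquality using (_≡_)

open import Data.Nat as ℕ using (NonZero; ≢-nonZero; ≢-nonZero⁻¹; >-nonZero)
open import Data.Nat.Properties using (*-comm; m<m*n; ≤∧≢⇒<; n≢0⇒n>0)
open import Data.Nat.Divisibility using (_∣_; divides; ∣-refl; ∣-trans; ∣1⇒≡1; ∣n⇒∣m*n)
open import Data.Nat.GCD using (gcd-GCD; module Bézout; gcd[m,n]∣m; gcd[m,n]∣n; gcd[m,n]≡0⇒m≡0)
open import Data.Nat.Coprimality as Coprime
  using (Coprime; coprime?; coprime⇒gcd≡1; gcd≡1⇒coprime; coprime-divisor)
open import Data.Nat.Induction using (<-wellFounded)
open import Induction.WellFounded using (Acc; acc)
open import Data.Integer using (1ℤ; -_; _-_)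
open import Data.Integer.Properties using (pos-+; pos-*; +-comm)
open import Data.Integer.Divisibility.Signed as ℤ using (∣ᵤ⇒∣; ∣⇒∣ᵤ)
open import Data.Integer.Tactic.RingSolver using (solve)
open import Data.List using (_∷_; [])
open import Data.Product using (_,_; ∃-syntax; ∃₂)
open import Function using (_∘_)
open import Relation.Nullary using (yes; no)
open import Relation.Binary.PropositionalEquality
  using (refl; sym; trans; cong; subst; module ≡-Reasoning)

coprime-∣ˡ : ∀ {d m n} → d ∣ m → Coprime m n → Coprime d n
coprime-∣ˡ d∣m m⊥n (c∣d , c∣n) = m⊥n (∣-trans c∣d d∣m , c∣n)

coprime-∣ʳ : ∀ {d m n} → d ∣ n → Coprime m n → Coprime m d
coprime-∣ʳ d∣n m⊥n (c∣m , c∣d) = m⊥n (c∣m , ∣-trans c∣d d∣n)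

coprime-part : ∀ w m .{{_ : NonZero m}} →
               ∃[ a ] Coprime a w × (∀ {d} → d ∣ m → Coprime d w → d ∣ a)
coprime-part w m = go m (<-wellFounded m)
  where
  go : ∀ m .{{_ : NonZero m}} → Acc _<_ m →
       ∃[ a ] Coprime a w × (∀ {d} → d ∣ m → Coprime d w → d ∣ a)
  go m (acc rec) with coprime? m w
  ... | yes m⊥w = m , m⊥w , λ d∣m _ → d∣m
  ... | no ¬m⊥w with gcd[m,n]∣m m w
  ... | divides q m≡q*e =
    let a , a⊥w , absorbs = go q (rec q<m) in a , a⊥w , λ d∣m d⊥w → absorbs (d∣q d∣m d⊥w) d⊥w
    where
    e : ℕ
    e = gcd m w
    instance
      q≢0 : NonZero q
      q≢0 = ≢-nonZero λ { refl → ≢-nonZero⁻¹ m m≡q*e }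
    1<e : 1 ℕ.< e
    1<e = ≤∧≢⇒< (n≢0⇒n>0 (≢-nonZero⁻¹ m ∘ gcd[m,n]≡0⇒m≡0)) (¬m⊥w ∘ gcd≡1⇒coprime ∘ sym)
    q<m : q < m
    q<m = subst (q <_) (sym m≡q*e) (m<m*n q e 1<e)
    d∣q : ∀ {d} → d ∣ m → Coprime d w → d ∣ q
    d∣q d∣m d⊥w = coprime-divisor (coprime-∣ʳ (gcd[m,n]∣n m w) d⊥w)
                                  (subst (_ ∣_) (trans m≡q*e (*-comm q e)) d∣m)

∣∣i∣⇒∣i : ∀ {c} i → c ∣ ∣ i ∣ → + c ℤ.∣ i
∣∣i∣⇒∣i _ = ∣ᵤ⇒∣

coprime-shift : ∀ y {g a n} → Coprime ∣ y ∣ g → Coprime a ∣ y ∣ →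
                (∀ {d} → d ∣ n → Coprime d ∣ y ∣ → d ∣ a) → Coprime ∣ y + + (g ℕ.* a) ∣ n
coprime-shift y {g} {a} y⊥g a⊥y absorbs {d} (d∣z , d∣n) = d⊥y (∣-refl , d∣y)
  where
  z : ℤ
  z = y + + (g ℕ.* a)
  d⊥y : Coprime d ∣ y ∣
  d⊥y {c} (c∣d , c∣y) = a⊥y (c∣a , c∣y)
    where
    c∣ga : c ∣ g ℕ.* a
    c∣ga = ∣⇒∣ᵤ (ℤ.∣m+n∣m⇒∣n (∣∣i∣⇒∣i z (∣-trans c∣d d∣z)) (∣∣i∣⇒∣i y c∣y))
    c∣a : c ∣ a
    c∣a = coprime-divisor (coprime-∣ˡ c∣y y⊥g) c∣ga
  d∣y : d ∣ ∣ y ∣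
  d∣y = ∣⇒∣ᵤ (ℤ.∣m+n∣n⇒∣m {m = y} (∣∣i∣⇒∣i z d∣z)
                                    (∣∣i∣⇒∣i (+ (g ℕ.* a)) (∣n⇒∣m*n g (absorbs d∣n d⊥y))))

bézout⇒coprime : ∀ i j k l → i * j + k * l ≡ 1ℤ → Coprime ∣ i ∣ ∣ l ∣
bézout⇒coprime i j k l ij+kl≡1 (c∣i , c∣l) =
  ∣1⇒≡1 (∣⇒∣ᵤ (subst (_ ℤ.∣_) ij+kl≡1
    (ℤ.∣m∣n⇒∣m+n (ℤ.∣m⇒∣m*n j (∣∣i∣⇒∣i i c∣i)) (ℤ.∣n⇒∣m*n k (∣∣i∣⇒∣i l c∣l)))))

pos-+-* : ∀ a b c → + (a ℕ.+ b ℕ.* c) ≡ + a + + b * + c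
pos-+-* a b c = trans (pos-+ a (b ℕ.* c)) (cong (λ t → + a + t) (pos-* b c))

d+yn≡xm⇒mx+n[-y]≡d : ∀ d x y m n → d + y * n ≡ x * m → m * x + n * - y ≡ d
d+yn≡xm⇒mx+n[-y]≡d d x y m n d+yn≡xm = begin
  m * x + n * - y     ≡⟨ solve (m ∷ n ∷ x ∷ y ∷ []) ⟩
  x * m - y * n       ≡⟨ cong (_- y * n) d+yn≡xm ⟨
  d + y * n - y * n   ≡⟨ solve (d ∷ y ∷ n ∷ []) ⟩
  d                   ∎
  where open ≡-Reasoning

identity⇒ℤ : ∀ {d m n} → Bézout.Identity d m n → ∃₂ λ u v → + m * u + + n * v ≡ + d
identity⇒ℤ {d} {m} {n} (Bézout.+- x y d+yn≡xm) =
  + x , - + y , d+yn≡xm⇒mx+n[-y]≡d (+ d) (+ x) (+ y) (+ m) (+ n) d+yn≡xmℤ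
  where
  d+yn≡xmℤ : + d + + y * + n ≡ + x * + m
  d+yn≡xmℤ = trans (sym (pos-+-* d y n)) (trans (cong +_ d+yn≡xm) (pos-* x m))
identity⇒ℤ {d} {m} {n} (Bézout.-+ x y d+xm≡yn) =
  let v , u , nv+mu≡d = identity⇒ℤ (Bézout.+- y x d+xm≡yn)
  in u , v , trans (+-comm (+ m * u) (+ n * v)) nv+mu≡d

bézout-ℤ : ∀ m n → ∃₂ λ u v → + m * u + + n * v ≡ + gcd m n
bézout-ℤ m n = identity⇒ℤ (Bézout.identity (gcd-GCD m n))

bézout-combine : ∀ n k r u v x y t {g} → n * u + k * v ≡ g → g * x + r * y ≡ 1ℤ →
                 n * (u * (x - r * t)) + k * (v * (x - r * t)) + r * (y + g * t) ≡ 1ℤ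
bézout-combine n k r u v x y t refl gx+ry≡1 = begin
  n * (u * (x - r * t)) + k * (v * (x - r * t)) + r * (y + (n * u + k * v) * t)
    ≡⟨ solve (n ∷ k ∷ r ∷ u ∷ v ∷ x ∷ y ∷ t ∷ []) ⟩
  (n * u + k * v) * x + r * y
    ≡⟨ gx+ry≡1 ⟩
  1ℤ ∎
  where open ≡-Reasoning

lemma4p4 : (n k r : ℕ) → 1 ≤ n → k ≤ n → r < n → gcd (gcd n k) r ≡ 1 →
    Σ ℤ λ x → Σ ℤ λ y → Σ ℤ λ z →
      ((+ n) * x + (+ k) * y + (+ r) * z ≡ + 1) × (gcd ∣ z ∣ n ≡ 1)
lemma4p4 n k r 1≤n _ _ gcd[g,r]≡1 =
  let g = gcd n k
      u , v , nu+kv≡g = bézout-ℤ n k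
      x , y , gx+ry≡gcd[g,r] = bézout-ℤ g r
      gx+ry≡1 = trans gx+ry≡gcd[g,r] (cong +_ gcd[g,r]≡1)
      a , a⊥y , absorbs = coprime-part ∣ y ∣ n {{>-nonZero 1≤n}}
      y⊥g = Coprime.sym (bézout⇒coprime (+ g) x (+ r) y gx+ry≡1)
      z⊥n = coprime-shift y {g} y⊥g a⊥y absorbs
  in u * (x - + r * + a) , v * (x - + r * + a) , y + + g * + a ,
     bézout-combine (+ n) (+ k) (+ r) u v x y (+ a) nu+kv≡g gx+ry≡1 ,
     coprime⇒gcd≡1 (subst (λ t → Coprime ∣ y + t ∣ n) (pos-* g a) z⊥n)
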